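{- Let $I=(G=(A,B;E),L)$ be an instance of the Stable Matching Problem, let $M$ be a matching of $G$ having exactly $k$ blocking edges in $I$, and let $\sigma$ be a swap. Then $M$ has at least $k-1$ blocking edges in the instance $\sigma(I)$ obtained by applying $\sigma$ to the preference lists.
   Context: An instance of the Stable Matching Problem is a bipartite graph $G=(A,B;E)$ together with a set $L$ of preference lists: for each vertex $v$, a strict ordering $\ell(v)$ of all neighbours of $v$ ($v$ prefers earlier elements). For a matching $M$, an edge $ab\in E\setminus M$ is blocking if ($a$ is unmatched in $M$ or $a$ prefers $b$ to its partner in $M$) and ($b$ is unmatched in $M$ or $b$ prefers $a$ to its partner in $M$). A swap exchanges two consecutive elements of one preference list. -}

module Defs where

open import Data.Nat using (ℕ; zero; suc; _<_; _≤_; _∸_)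
open import Data.Nat.Properties using (_<?_)
open import Data.Fin using (Fin)
open import Data.Fin.Properties using (_≟_)
open import Data.Bool using (Bool; T)
open import Data.Maybe using (Maybe; just; nothing)
open import Data.List using (List; []; _∷_; length; filter; allFin; cartesianProduct)
open import Data.List.Membership.Propositional using (_∈_)
open import Data.List.Relation.Unary.Unique.Propositional using (Unique)
open import Data.Product using (_×_; _,_; Σ)
open import Data.Sum using (_⊎_; inj₁; inj₂)
open import Relation.Binary.PropositionalEquality using (_≡_; _≢_; refl)
open import Relation.Nullary using (Dec; yes; no; ¬_)
open import Relation.Nullary.Decidable using (_×-dec_; _⊎-dec_; ¬?)
open import Function.Bundles using (_⇔_)

record Graph (nA nB : ℕ) : Set where
  field
    edge : Fin nA → Fin nB → Bool

-- Position of x in a list (0-based); the length of the list if absent.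
pos : ∀ {n} → List (Fin n) → Fin n → ℕ
pos []       x = zero
pos (y ∷ ys) x with y ≟ x
... | yes _ = zero
... | no  _ = suc (pos ys x)

Prefers : ∀ {n} → List (Fin n) → Fin n → Fin n → Set
Prefers l x y = pos l x < pos l y

prefers? : ∀ {n} (l : List (Fin n)) (x y : Fin n) → Dec (Prefers l x y)
prefers? l x y = pos l x <? pos l y

-- Preference lists: for each vertex a strict ordering (a duplicate-free
-- list) of exactly its neighbours.
record Prefs {nA nB : ℕ} (G : Graph nA nB) : Set where
  open Graph G
  field
    ℓA : Fin nA → List (Fin nB)
    ℓB : Fin nB → List (Fin nA)

ValidPrefs : ∀ {nA nB} (G : Graph nA nB) → Prefs G → Set
ValidPrefs {nA} {nB} G L =
    (∀ a → Unique (ℓA a)) × (∀ b → Unique (ℓB b))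
  × (∀ a b → (b ∈ ℓA a) ⇔ T (edge a b))
  × (∀ a b → (a ∈ ℓB b) ⇔ T (edge a b))
  where open Graph G; open Prefs L

record Matching {nA nB : ℕ} (G : Graph nA nB) : Set where
  field
    mA : Fin nA → Maybe (Fin nB)
    mB : Fin nB → Maybe (Fin nA)

IsMatching : ∀ {nA nB} (G : Graph nA nB) → Matching G → Set
IsMatching {nA} {nB} G M =
    (∀ a b → (mA a ≡ just b) ⇔ (mB b ≡ just a))
  × (∀ a b → mA a ≡ just b → T (Graph.edge G a b))
  where open Matching M

UnmatchedOrPrefers : ∀ {n} → List (Fin n) → Maybe (Fin n) → Fin n → Set
UnmatchedOrPrefers l nothing  w = Data.Unit.⊤ where import Data.Unit
UnmatchedOrPrefers l (just p) w = Prefers l w p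

unmatchedOrPrefers? : ∀ {n} (l : List (Fin n)) (m : Maybe (Fin n)) (w : Fin n)
                    → Dec (UnmatchedOrPrefers l m w)
unmatchedOrPrefers? l nothing  w = yes _
unmatchedOrPrefers? l (just p) w = prefers? l w p

inMatching? : ∀ {n} (m : Maybe (Fin n)) (b : Fin n) → Dec (m ≡ just b)
inMatching? nothing  b = no λ ()
inMatching? (just p) b with p ≟ b
... | yes refl = yes refl
... | no  p≢b  = no λ { refl → p≢b refl }

Blocking : ∀ {nA nB} (G : Graph nA nB) → Prefs G → Matching G
         → Fin nA → Fin nB → Set
Blocking G L M a b =
    T (Graph.edge G a b)
  × ¬ (Matching.mA M a ≡ just b)
  × UnmatchedOrPrefers (Prefs.ℓA L a) (Matching.mA M a) b
  × UnmatchedOrPrefers (Prefs.ℓB L b) (Matching.mB M b) a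

blocking? : ∀ {nA nB} (G : Graph nA nB) (L : Prefs G) (M : Matching G)
          → (e : Fin nA × Fin nB) → Dec (Blocking G L M (Data.Product.proj₁ e) (Data.Product.proj₂ e))
blocking? G L M (a , b) =
  Data.Bool.T? (Graph.edge G a b)
  ×-dec ¬? (inMatching? (Matching.mA M a) b)
  ×-dec unmatchedOrPrefers? (Prefs.ℓA L a) (Matching.mA M a) b
  ×-dec unmatchedOrPrefers? (Prefs.ℓB L b) (Matching.mB M b) a

numBlocking : ∀ {nA nB} (G : Graph nA nB) → Prefs G → Matching G → ℕ
numBlocking {nA} {nB} G L M =
  length (filter (blocking? G L M) (cartesianProduct (allFin nA) (allFin nB)))

swapAt : ∀ {X : Set} → ℕ → List X → List X
swapAt zero    (x ∷ y ∷ xs) = y ∷ x ∷ xs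
swapAt (suc i) (x ∷ xs)     = x ∷ swapAt i xs
swapAt _       xs           = xs

data Swap {nA nB : ℕ} {G : Graph nA nB} (L : Prefs G) : Set where
  swapA : (a : Fin nA) (i : ℕ) → suc i < length (Prefs.ℓA L a) → Swap L
  swapB : (b : Fin nB) (i : ℕ) → suc i < length (Prefs.ℓB L b) → Swap L

updateAt : ∀ {n} {X : Set} → (Fin n → X) → Fin n → (X → X) → Fin n → X
updateAt f v g w with v ≟ w
... | yes _ = g (f w)
... | no  _ = f w

applySwap : ∀ {nA nB} {G : Graph nA nB} (L : Prefs G) → Swap L → Prefs G
applySwap L (swapA a i _) = record { ℓA = updateAt (Prefs.ℓA L) a (swapAt i) ; ℓB = Prefs.ℓB L }
applySwap L (swapB b i _) = record { ℓA = Prefs.ℓA L ; ℓB = updateAt (Prefs.ℓB L) b (swapAt i) }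

-- A swap at positions i, i+1 of a vertex v's list changes only the relative
-- order of the two entries there, and only the entry at position i gets worse.
-- Hence every blocking edge stays blocking, except possibly the single edge
-- joining v to that entry, and at most one blocking edge is lost.
module Submission where

open import Defs
open import Data.Nat using (ℕ; zero; suc; _≤_; _<_; _+_; _∸_; z≤n; s≤s)
open import Data.Nat.Properties
  using (≤-refl; ≤-reflexive; ≤-trans; ≤-pred; <⇒≤; <-irrefl; n≮0; n≤1+n; 1+n≢0; suc-injective;
         +-suc; +-mono-≤; +-monoˡ-≤; ∸-monoˡ-≤)
import Data.Nat.Properties as ℕ
open import Data.Fin using (Fin)
open import Data.Fin.Properties using (_≟_)
open import Data.List using (List; []; _∷_; length; filter; allFin; cartesianProduct)
open import Data.List.Properties using (filter-accept; filter-none)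
import Data.List.Relation.Unary.All as All
open import Data.List.Relation.Unary.AllPairs using (_∷_)
open import Data.List.Relation.Unary.Unique.Propositional using (Unique)
open import Data.List.Relation.Unary.Unique.Propositional.Properties using (cartesianProduct⁺; allFin⁺)
open import Data.Maybe using (just; nothing)
open import Data.Product using (_×_; _,_; uncurry)
open import Data.Sum using (_⊎_; inj₁; inj₂)
open import Data.Empty using (⊥-elim)
open import Relation.Binary.PropositionalEquality using (_≡_; _≢_; refl; sym; trans; cong)
open import Relation.Nullary using (yes; no; ¬_)
open import Relation.Nullary.Decidable using (_×-dec_)
open import Relation.Unary using (Pred; Decidable)

module _ {a p} {A : Set a} {P : Pred A p} (P? : Decidable P) where

  length-filter-∷ : ∀ x xs → length (filter P? xs) ≤ length (filter P? (x ∷ xs))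
  length-filter-∷ x xs with P? x
  ... | yes _ = n≤1+n _
  ... | no  _ = ≤-refl

  length-filter-accept : ∀ {x xs} → P x → length (filter P? (x ∷ xs)) ≡ suc (length (filter P? xs))
  length-filter-accept px = cong length (filter-accept P? px)

  length-filter-≤1 : (∀ {x y} → P x → P y → x ≡ y) →
                     ∀ {xs} → Unique xs → length (filter P? xs) ≤ 1
  length-filter-≤1 P-unique {[]}     _          = z≤n
  length-filter-≤1 P-unique {x ∷ xs} (x∉ ∷ xs!) with P? x
  ... | no  _  = length-filter-≤1 P-unique xs!
  ... | yes px rewrite filter-none P? (All.map (λ x≢y py → x≢y (P-unique px py)) x∉) = s≤s z≤n

module _ {a p q e} {A : Set a} {P : Pred A p} {Q : Pred A q} {E : Pred A e}
         (P? : Decidable P) (E? : Decidable E) (Q? : Decidable Q) where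

  length-filter-≤-+ : (∀ {x} → P x → E x ⊎ Q x) → ∀ xs →
    length (filter P? xs) ≤ length (filter E? xs) + length (filter Q? xs)
  length-filter-≤-+ P⊆E∪Q []       = z≤n
  length-filter-≤-+ P⊆E∪Q (x ∷ xs) with ih ← length-filter-≤-+ P⊆E∪Q xs | P? x
  ... | no _ = ≤-trans ih (+-mono-≤ (length-filter-∷ E? x xs) (length-filter-∷ Q? x xs))
  ... | yes px with P⊆E∪Q px
  ...   | inj₁ ex = ≤-trans (s≤s ih)
    (+-mono-≤ (≤-reflexive (sym (length-filter-accept E? ex))) (length-filter-∷ Q? x xs))
  ...   | inj₂ qx = ≤-trans (s≤s ih) (≤-trans (≤-reflexive (sym (+-suc _ _)))
    (+-mono-≤ (length-filter-∷ E? x xs) (≤-reflexive (sym (length-filter-accept Q? qx)))))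

module _ {n : ℕ} where

  pos-∷-self : ∀ (x : Fin n) xs → pos (x ∷ xs) x ≡ 0
  pos-∷-self x xs with x ≟ x
  ... | yes _   = refl
  ... | no x≢x = ⊥-elim (x≢x refl)

  pos-∷-≢ : ∀ {x b : Fin n} xs → x ≢ b → pos (x ∷ xs) b ≡ suc (pos xs b)
  pos-∷-≢ {x} {b} xs x≢b with x ≟ b
  ... | yes x≡b = ⊥-elim (x≢b x≡b)
  ... | no _    = refl

  prefers-swapAt-head : ∀ {x y b c : Fin n} {xs} → x ≢ b →
    Prefers (x ∷ y ∷ xs) b c → Prefers (y ∷ x ∷ xs) b c
  prefers-swapAt-head {x} {y} {b} {c} {xs} x≢b b<c with x ≟ b | x ≟ c
  ... | yes x≡b | _      = ⊥-elim (x≢b x≡b)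
  ... | no _    | yes _  = ⊥-elim (n≮0 b<c)
  ... | no x≢b′ | no x≢c with y ≟ b | y ≟ c
  ...   | yes _ | yes _ = ⊥-elim (<-irrefl refl b<c)
  ...   | yes _ | no _  = s≤s z≤n
  ...   | no _  | yes _ = ⊥-elim (n≮0 (≤-pred b<c))
  ...   | no _  | no _  rewrite pos-∷-≢ xs x≢b′ | pos-∷-≢ xs x≢c = b<c

  prefers-swapAt : ∀ {b c : Fin n} i l → pos l b ≢ i → Prefers l b c → Prefers (swapAt i l) b c
  prefers-swapAt zero    []           b≢i b<c = b<c
  prefers-swapAt zero    (x ∷ [])     b≢i b<c = b<c
  prefers-swapAt zero    (x ∷ y ∷ xs) b≢i b<c =
    prefers-swapAt-head (λ { refl → b≢i (pos-∷-self x (y ∷ xs)) }) b<c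
  prefers-swapAt (suc i) []       b≢i b<c = b<c
  prefers-swapAt {b} {c} (suc i) (x ∷ xs) b≢i b<c with x ≟ b | x ≟ c
  ... | yes _ | yes _ = ⊥-elim (<-irrefl refl b<c)
  ... | yes _ | no _  = s≤s z≤n
  ... | no _  | yes _ = ⊥-elim (n≮0 b<c)
  ... | no _  | no _  = s≤s (prefers-swapAt i xs (λ b≡i → b≢i (cong suc b≡i)) (≤-pred b<c))

  unmatchedOrPrefers-swapAt : ∀ {b : Fin n} i l m → pos l b ≢ i →
    UnmatchedOrPrefers l m b → UnmatchedOrPrefers (swapAt i l) m b
  unmatchedOrPrefers-swapAt i l nothing  b≢i _   = _
  unmatchedOrPrefers-swapAt i l (just c) b≢i b<c = prefers-swapAt i l b≢i b<c

  pos-injective : ∀ {b c : Fin n} {i} l → i < length l → pos l b ≡ i → pos l c ≡ i → b ≡ c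
  pos-injective {b} {c} {i} (x ∷ xs) i<len b≡i c≡i with x ≟ b | x ≟ c | i
  ... | yes x≡b | yes x≡c | _     = trans (sym x≡b) x≡c
  ... | yes _   | no _    | _     = ⊥-elim (1+n≢0 (trans c≡i (sym b≡i)))
  ... | no _    | yes _   | _     = ⊥-elim (1+n≢0 (trans b≡i (sym c≡i)))
  ... | no _    | no _    | zero  = ⊥-elim (1+n≢0 b≡i)
  ... | no _    | no _    | suc j =
    pos-injective xs (≤-pred i<len) (suc-injective b≡i) (suc-injective c≡i)

module _ {nA nB : ℕ} {G : Graph nA nB} (L : Prefs G) where
  open Prefs L

  Demoted : Swap L → Fin nA × Fin nB → Set
  Demoted (swapA a₀ i _) (a , b) = a₀ ≡ a × pos (ℓA a₀) b ≡ i
  Demoted (swapB b₀ i _) (a , b) = b₀ ≡ b × pos (ℓB b₀) a ≡ i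

  demoted? : ∀ σ → Decidable (Demoted σ)
  demoted? (swapA a₀ i _) (a , b) = (a₀ ≟ a) ×-dec (pos (ℓA a₀) b ℕ.≟ i)
  demoted? (swapB b₀ i _) (a , b) = (b₀ ≟ b) ×-dec (pos (ℓB b₀) a ℕ.≟ i)

  demoted-unique : ∀ σ {e e′} → Demoted σ e → Demoted σ e′ → e ≡ e′
  demoted-unique (swapA a₀ i i+1<len) (refl , b≡i) (refl , b′≡i) =
    cong (a₀ ,_) (pos-injective (ℓA a₀) (<⇒≤ i+1<len) b≡i b′≡i)
  demoted-unique (swapB b₀ i i+1<len) (refl , a≡i) (refl , a′≡i) =
    cong (_, b₀) (pos-injective (ℓB b₀) (<⇒≤ i+1<len) a≡i a′≡i)

module _ {nA nB : ℕ} {G : Graph nA nB} (L : Prefs G) (M : Matching G) where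
  open Prefs L
  open Matching M

  blocking-applySwap : ∀ σ e → ¬ Demoted L σ e →
    uncurry (Blocking G L M) e → uncurry (Blocking G (applySwap L σ) M) e
  blocking-applySwap (swapA a₀ i _) (a , b) ¬d (ab∈E , ab∉M , a-wants-b , b-wants-a) with a₀ ≟ a
  ... | yes refl = ab∈E , ab∉M ,
        unmatchedOrPrefers-swapAt i (ℓA a₀) (mA a₀) (λ b≡i → ¬d (refl , b≡i)) a-wants-b , b-wants-a
  ... | no _ = ab∈E , ab∉M , a-wants-b , b-wants-a
  blocking-applySwap (swapB b₀ i _) (a , b) ¬d (ab∈E , ab∉M , a-wants-b , b-wants-a) with b₀ ≟ b
  ... | yes refl = ab∈E , ab∉M , a-wants-b ,
        unmatchedOrPrefers-swapAt i (ℓB b₀) (mB b₀) (λ a≡i → ¬d (refl , a≡i)) b-wants-a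
  ... | no _ = ab∈E , ab∉M , a-wants-b , b-wants-a

  numBlocking-applySwap : ∀ σ → numBlocking G L M ≤ suc (numBlocking G (applySwap L σ) M)
  numBlocking-applySwap σ =
    ≤-trans (length-filter-≤-+ (blocking? G L M) (demoted? L σ) (blocking? G (applySwap L σ) M)
                               demoted-or-blocking edges)
            (+-monoˡ-≤ _ (length-filter-≤1 (demoted? L σ) (demoted-unique L σ) edges-unique))
    where
    edges : List (Fin nA × Fin nB)
    edges = cartesianProduct (allFin nA) (allFin nB)

    edges-unique : Unique edges
    edges-unique = cartesianProduct⁺ (allFin⁺ nA) (allFin⁺ nB)

    demoted-or-blocking : ∀ {e} → uncurry (Blocking G L M) e →
                          Demoted L σ e ⊎ uncurry (Blocking G (applySwap L σ) M) e
    demoted-or-blocking {e} blocks with demoted? L σ e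
    ... | yes d  = inj₁ d
    ... | no ¬d = inj₂ (blocking-applySwap σ e ¬d blocks)

mainTheorem4 : ∀ {nA nB : ℕ} (G : Graph nA nB) (L : Prefs G) → ValidPrefs G L
             → (M : Matching G) → IsMatching G M
             → (k : ℕ) → numBlocking G L M ≡ k
             → (σ : Swap L)
             → k ∸ 1 ≤ numBlocking G (applySwap L σ) M
mainTheorem4 G L _ M _ k refl σ = ∸-monoˡ-≤ 1 (numBlocking-applySwap L M σ)
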